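{- For all positive integers $n,s,k$ with $1 \leq s < k < n$, there exists an $s$-overlap cycle on the set of all $k$-permutations of $[n]=\{1,2,\ldots,n\}$.
   Context: A $k$-permutation of $[n]$ is a string $a_1a_2\ldots a_k$ of $k$ pairwise distinct elements of $[n]$. For a finite set $\mathcal{C}$ of strings, each of length $k$, and an integer $1 \le s < k$, an $s$-overlap cycle ($s$-ocycle) on $\mathcal{C}$ is a cyclic ordering $c^{(1)}, \ldots, c^{(N)}$ of all elements of $\mathcal{C}$, each appearing exactly once, such that for every $j$ (indices taken cyclically, so $c^{(N)}$ is followed by $c^{(1)}$), the last $s$ letters of $c^{(j)}$ equal the first $s$ letters of $c^{(j+1)}$; that is, if $a=a_1\ldots a_k$ is followed by $b=b_1\ldots b_k$ then $a_{k-s+1}\ldots a_k = b_1\ldots b_s$. -}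

module Defs where

open import Data.Nat using (ℕ; _∸_)
open import Data.Fin using (Fin)
open import Data.Vec using (Vec; toList)
open import Data.List using (List; []; _∷_; take; drop; length)
open import Data.List.Relation.Unary.Unique.Propositional using (Unique)
open import Data.List.Membership.Propositional using (_∈_)
open import Data.Product using (_×_)
open import Data.Unit using (⊤)
open import Data.Empty using (⊥)
open import Relation.Binary.PropositionalEquality using (_≡_)

-- Strings of length k over the alphabet [n] = Fin n (letter i+1 ↔ Fin index i).
Word : ℕ → ℕ → Set
Word n k = Vec (Fin n) k

IsKPerm : ∀ {n k} → Word n k → Set
IsKPerm w = Unique (toList w)

Overlaps : ∀ {n k} → ℕ → Word n k → Word n k → Set
Overlaps {k = k} s a b = drop (k ∸ s) (toList a) ≡ take s (toList b)

-- every element of the list is followed by the next one with overlap s;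
-- `first` is the element following the last one (cyclic wrap-around)
CyclicChain : ∀ {n k} → ℕ → Word n k → List (Word n k) → Set
CyclicChain s first []            = ⊤
CyclicChain s first (x ∷ [])      = Overlaps s x first
CyclicChain s first (x ∷ y ∷ ys)  = Overlaps s x y × CyclicChain s first (y ∷ ys)

IsCyclicOverlap : ∀ {n k} → ℕ → List (Word n k) → Set
IsCyclicOverlap s []       = ⊤
IsCyclicOverlap s (c ∷ cs) = CyclicChain s c (c ∷ cs)

record OCycleOnKPerms (n k s : ℕ) : Set where
  field
    cycle      : List (Word n k)
    distinct   : Unique cycle
    onlyPerms  : ∀ {w} → w ∈ cycle → IsKPerm w
    allPerms   : ∀ (w : Word n k) → IsKPerm w → w ∈ cycle
    overlaps   : IsCyclicOverlap s cycle

module Submission where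

-- Let r = k - s.  Regard each k-permutation w as an edge of a directed multigraph on
-- letter lists, running from its first s letters (src w) to its last s letters (tgt w).  An
-- s-overlap cycle on all k-permutations is exactly an Eulerian circuit of this graph.
--  * Rotating a word by r letters is an injective map σ with src (σ w) = tgt w, so each
--    σ-orbit, listed in order, is a circuit, and the orbits split the edges into disjoint
--    circuits.
--  * Any two s-permutations are joined by an undirected path: a single letter can be changed
--    to an unused one by padding with r fresh letters (this needs k < n) and following edges;
--    letters are then aligned one at a time (using s < n for a spare letter).
--  * Circuits sharing a vertex splice into one; by connectivity the main circuit always meets
--    another one until a single circuit through all edges remains (Hierholzer).

open import Defs
open import Data.Nat using (ℕ; zero; suc; _≤_; _<_; _+_; _∸_; _⊓_; z≤n; s≤s; _<?_)
open import Data.Nat.Properties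
  using (≤-trans; ≤-refl; +-suc; +-identityʳ; <-irrefl; suc-injective; n<1+n; <-≤-trans; m≤m+n;
         m∸[m∸n]≡n; m+[n∸m]≡n; m≤n⇒m⊓n≡m; m∸n≤m; ∸-monoʳ-<; <⇒≤; ≮⇒≥; ≤-pred; <-trans; m<n⇒0<n∸m)
open import Data.Product using (_×_; _,_; Σ; proj₁; proj₂)
open import Data.Sum using (_⊎_; inj₁; inj₂)
open import Data.Empty using (⊥; ⊥-elim)
open import Data.Unit using (⊤; tt)
open import Function using (_∘_; id)
open import Function.Bundles using (_⇔_; mk⇔; Equivalence)
open import Function.Construct.Symmetry using (⇔-sym)
open import Function.Construct.Composition using (_⇔-∘_)
open import Relation.Nullary using (Dec; yes; no; ¬?)
open import Relation.Nullary.Decidable using (decidable-stable)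
open import Relation.Binary.Definitions using (DecidableEquality)
open import Relation.Binary.PropositionalEquality
  using (_≡_; _≢_; refl; sym; trans; cong; cong₂; subst; subst₂; setoid; module ≡-Reasoning)
open import Data.Fin using (Fin)
import Data.Fin as Fin
open import Data.Vec using (Vec; []; _∷_; toList; _∷ʳ_; cast; fromList)
open import Data.Vec.Properties using (∷ʳ-injective; length-toList; toList-∷ʳ; toList-cast; toList∘fromList)
import Data.Vec.Properties as Vecₚ
open import Data.List using (List; []; _∷_; _++_; [_]; length; concat; concatMap; map; filter; take; drop; iterate; allFin)
import Data.List.Properties as List
import Data.Nat.GeneralisedArithmetic as ℕ
open import Data.List.Relation.Unary.Any using (Any; here; there; any?)
import Data.List.Relation.Unary.Any as Any
open import Data.List.Relation.Unary.All using (All; []; _∷_)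
import Data.List.Relation.Unary.All.Properties as All
open import Data.List.Relation.Unary.AllPairs using ([]; _∷_)
open import Data.List.Membership.Propositional using (_∈_; _∉_; find)
open import Data.List.Membership.Propositional.Properties
  using (∈-++⁻; ∈-++⁺ˡ; ∈-++⁺ʳ; ∈-∃++; ∈-concat⁻; ∈-map⁻; ∈-map⁺; ∈-filter⁻; ∈-filter⁺; ∈-allFin; ∈-concatMap⁺)
import Data.List.Membership.DecPropositional as DecMembership
open import Data.List.Relation.Unary.Unique.Propositional using (Unique)
open import Data.List.Relation.Unary.Unique.DecPropositional using (unique?)
open import Data.List.Relation.Unary.Unique.Propositional.Properties
  using (Unique[x∷xs]⇒x∉xs; allFin⁺; take⁺; drop⁺) renaming (++⁺ to Unique-++⁺)
open import Data.List.Relation.Binary.Permutation.Propositional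
  using (_↭_; ↭-refl; ↭-sym; ↭-trans; ↭-reflexive; ↭⇒↭ₛ; module PermutationReasoning)
open import Data.List.Relation.Binary.Permutation.Propositional.Properties
  using (∈-resp-↭; ++-comm; ++⁺ˡ; ++⁺ʳ; ++⁺; shift; shifts; ↭-length)
import Data.List.Relation.Binary.Permutation.Setoid.Properties as Permutationₛ

module _ {A : Set} where

  unique-↭ : ∀ {xs ys : List A} → xs ↭ ys → Unique xs → Unique ys
  unique-↭ p = Permutationₛ.Unique-resp-↭ (setoid A) (↭⇒↭ₛ p)

  unique-∉ : ∀ (a : List A) {y b} → Unique (a ++ y ∷ b) → y ∉ a ++ b
  unique-∉ a {y} {b} u = Unique[x∷xs]⇒x∉xs (unique-↭ (shift y a b) u)

  ∈-removed : ∀ (a : List A) {z b w} → w ∈ a ++ z ∷ b → w ≡ z ⊎ w ∈ a ++ b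
  ∈-removed a {z} {b} m with ∈-resp-↭ (shift z a b) m
  ... | here eq  = inj₁ eq
  ... | there m′ = inj₂ m′

  ∈-inserted : ∀ (a : List A) {x b z} → z ∈ a ++ b → z ∈ a ++ x ∷ b
  ∈-inserted a m with ∈-++⁻ a m
  ... | inj₁ m₁ = ∈-++⁺ˡ m₁
  ... | inj₂ m₂ = ∈-++⁺ʳ a (there m₂)

  unique-replace : ∀ (a : List A) {x y b} → Unique (a ++ x ∷ b) → y ∉ a ++ x ∷ b → Unique (a ++ y ∷ b)
  unique-replace a {x} {y} {b} u y∉ with unique-↭ (shift x a b) u
  ... | _ ∷ u′ = unique-↭ (↭-sym (shift y a b)) (All.¬Any⇒All¬ (a ++ b) (y∉ ∘ ∈-inserted a) ∷ u′)

  length-replace : ∀ (a : List A) {x y b} → length (a ++ y ∷ b) ≡ length (a ++ x ∷ b)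
  length-replace []      = refl
  length-replace (_ ∷ a) = cong suc (length-replace a)

  unique-length-≤ : ∀ {xs ys : List A} → Unique xs → (∀ {x} → x ∈ xs → x ∈ ys) → length xs ≤ length ys
  unique-length-≤ {[]}     u        xs⊆ys = z≤n
  unique-length-≤ {x ∷ xs} (x∉ ∷ u) xs⊆ys with ∈-∃++ (xs⊆ys (here refl))
  ... | a , b , refl = subst (suc (length xs) ≤_) (sym (↭-length (shift x a b)))
                         (s≤s (unique-length-≤ u xs⊆a++b))
    where
    xs⊆a++b : ∀ {z} → z ∈ xs → z ∈ a ++ b
    xs⊆a++b {z} m with ∈-removed a (xs⊆ys (there m))
    ... | inj₁ refl = ⊥-elim (Unique[x∷xs]⇒x∉xs (x∉ ∷ u) m)
    ... | inj₂ m′   = m′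

  concat-remove-↭ : ∀ (Ts₁ : List (List A)) T Ts₂ → T ++ concat (Ts₁ ++ Ts₂) ↭ concat (Ts₁ ++ T ∷ Ts₂)
  concat-remove-↭ Ts₁ T Ts₂ = begin
    T ++ concat (Ts₁ ++ Ts₂)           ≡⟨ cong (T ++_) (List.concat-++ Ts₁ Ts₂) ⟨
    T ++ concat Ts₁ ++ concat Ts₂      ↭⟨ shifts T (concat Ts₁) ⟩
    concat Ts₁ ++ T ++ concat Ts₂      ≡⟨ List.concat-++ Ts₁ (T ∷ Ts₂) ⟩
    concat (Ts₁ ++ T ∷ Ts₂)            ∎
    where open PermutationReasoning

  take-++-length : ∀ m (xs ys : List A) → length xs ≡ m → take m (xs ++ ys) ≡ xs
  take-++-length zero    []       ys refl = refl
  take-++-length (suc m) (x ∷ xs) ys eq   = cong (x ∷_) (take-++-length m xs ys (suc-injective eq))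

  drop-++-≤ : ∀ r (u z : List A) → r ≤ length u → drop r (u ++ z) ≡ drop r u ++ z
  drop-++-≤ zero    u       z _         = refl
  drop-++-≤ (suc r) (_ ∷ u) z (s≤s r≤u) = drop-++-≤ r u z r≤u

  drop-beyond : ∀ r (u : List A) {x y} z → length u < r → drop r (u ++ x ∷ z) ≡ drop r (u ++ y ∷ z)
  drop-beyond (suc r) []      z _        = refl
  drop-beyond (suc r) (_ ∷ u) z (s≤s lt) = drop-beyond r u z lt

  ∈-drop : ∀ r {l : List A} {y} → y ∈ drop r l → y ∈ l
  ∈-drop r {l} m = subst (_ ∈_) (List.take++drop≡id r l) (∈-++⁺ʳ (take r l) m)

  take-drop-step : ∀ r (l : List A) → r < length l →
                   Σ A λ y → drop r l ≡ y ∷ drop (suc r) l × take (suc r) l ≡ take r l ++ [ y ]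
  take-drop-step zero    (x ∷ l) _        = x , refl , refl
  take-drop-step (suc r) (x ∷ l) (s≤s lt) with take-drop-step r l lt
  ... | y , drop≡ , take≡ = y , drop≡ , cong (x ∷_) take≡

module Trails {E V : Set} (src tgt : E → V) where

  Walk : V → V → List E → Set
  Walk u v []       = u ≡ v
  Walk u v (e ∷ es) = src e ≡ u × Walk (tgt e) v es

  walk-++ : ∀ {u m v} A {B} → Walk u m A → Walk m v B → Walk u v (A ++ B)
  walk-++ []      refl          w  = w
  walk-++ (_ ∷ A) (start , w₁) w₂ = start , walk-++ A w₁ w₂

  walk-split : ∀ {u v} A {B} → Walk u v (A ++ B) → Σ V λ m → Walk u m A × Walk m v B
  walk-split []      w = _ , refl , w
  walk-split (_ ∷ A) (start , w) with walk-split A w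
  ... | m , w₁ , w₂ = m , (start , w₁) , w₂

  Circuit : List E → Set
  Circuit []       = ⊥
  Circuit (e ∷ es) = Walk (src e) (src e) (e ∷ es)

  Circuit⁰ : List E → Set
  Circuit⁰ []       = ⊤
  Circuit⁰ (e ∷ es) = Circuit (e ∷ es)

  circuit-closed : ∀ T → Circuit T → Σ V λ v → Walk v v T
  circuit-closed (e ∷ _) w = src e , w

  circuit-rotate : ∀ A e B → Circuit (A ++ e ∷ B) → Circuit (e ∷ B ++ A)
  circuit-rotate A e B c with circuit-closed (A ++ e ∷ B) c
  ... | v , w with walk-split A w
  ... | m , wA , (start , wB) = refl , walk-++ B wB (subst (λ z → Walk v z A) (sym start) wA)

  splice : ∀ A e B A′ f B′ → Circuit (A ++ e ∷ B) → Circuit (A′ ++ f ∷ B′) → src e ≡ src f →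
           Circuit ((e ∷ B ++ A) ++ (f ∷ B′ ++ A′))
  splice A e B A′ f B′ c c′ same =
    walk-++ (e ∷ B ++ A) (circuit-rotate A e B c)
      (subst (λ z → Walk z z (f ∷ B′ ++ A′)) (sym same) (circuit-rotate A′ f B′ c′))

  Visits : List E → V → Set
  Visits C u = Any (λ e → src e ≡ u) C

  visits-src : ∀ {e} T → e ∈ T → Visits T (src e)
  visits-src T = Any.map (λ e≡ → cong src (sym e≡))

  walk-visits-tgt : ∀ {u v e} T → Walk u v T → e ∈ T → Visits T (tgt e) ⊎ tgt e ≡ v
  walk-visits-tgt (_ ∷ [])    (_ , w)       (here refl) = inj₂ w
  walk-visits-tgt (_ ∷ _ ∷ _) (_ , nxt , _) (here refl) = inj₁ (there (here nxt))
  walk-visits-tgt (_ ∷ T)     (_ , w)       (there m) with walk-visits-tgt T w m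
  ... | inj₁ vis = inj₁ (there vis)
  ... | inj₂ eq  = inj₂ eq

  circuit-visits-tgt : ∀ {e} T → Circuit T → e ∈ T → Visits T (tgt e)
  circuit-visits-tgt (x ∷ T) c m with walk-visits-tgt (x ∷ T) c m
  ... | inj₁ vis = vis
  ... | inj₂ eq  = here (sym eq)

  module Splicing (_≟_ : DecidableEquality V) (Edge : E → Set) where

    data Connected : V → V → Set where
      c-refl  : ∀ {u} → Connected u u
      c-sym   : ∀ {u v} → Connected u v → Connected v u
      c-trans : ∀ {u v w} → Connected u v → Connected v w → Connected u w
      c-edge  : ∀ {e} → Edge e → Connected (src e) (tgt e)

    ≡⇒Connected : ∀ {u v} → u ≡ v → Connected u v
    ≡⇒Connected refl = c-refl

    Meets : List E → List (List E) → Set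
    Meets C Ts = Σ V λ u → Visits C u × Any (λ T → Visits T u) Ts

    visits-tgt-some : ∀ {e} Ts → All Circuit Ts → Any (e ∈_) Ts → Any (λ T → Visits T (tgt e)) Ts
    visits-tgt-some (T ∷ _)  (c ∷ _)  (here e∈T) = here (circuit-visits-tgt T c e∈T)
    visits-tgt-some (_ ∷ Ts) (_ ∷ cs) (there e∈) = there (visits-tgt-some Ts cs e∈)

    meets-or-invariant : ∀ C Ts → Circuit C → All Circuit Ts → (∀ {e} → Edge e → e ∈ C ++ concat Ts) →
                         ∀ {u v} → Connected u v → Meets C Ts ⊎ (Visits C u ⇔ Visits C v)
    meets-or-invariant C Ts c cs covered c-refl = inj₂ (mk⇔ id id)
    meets-or-invariant C Ts c cs covered (c-sym p) with meets-or-invariant C Ts c cs covered p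
    ... | inj₁ meets = inj₁ meets
    ... | inj₂ iff   = inj₂ (⇔-sym iff)
    meets-or-invariant C Ts c cs covered (c-trans p q)
      with meets-or-invariant C Ts c cs covered p | meets-or-invariant C Ts c cs covered q
    ... | inj₁ meets | _          = inj₁ meets
    ... | inj₂ _     | inj₁ meets = inj₁ meets
    ... | inj₂ iff₁  | inj₂ iff₂  = inj₂ (iff₂ ⇔-∘ iff₁)
    meets-or-invariant C Ts c cs covered (c-edge {e} edge) with ∈-++⁻ C (covered edge)
    ... | inj₁ e∈C = inj₂ (mk⇔ (λ _ → circuit-visits-tgt C c e∈C) (λ _ → visits-src C e∈C))
    ... | inj₂ e∈Ts with ∈-concat⁻ Ts e∈Ts | any? (λ x → src x ≟ src e) C | any? (λ x → src x ≟ tgt e) C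
    ...   | e∈T | yes vis | _       = inj₁ (src e , vis , Any.map (visits-src _) e∈T)
    ...   | e∈T | no _    | yes vis = inj₁ (tgt e , vis , visits-tgt-some Ts cs e∈T)
    ...   | _   | no ¬vis | no ¬vis′ = inj₂ (mk⇔ (⊥-elim ∘ ¬vis) (⊥-elim ∘ ¬vis′))

    record Decomposition (M : List E) : Set where
      constructor decomposition
      field
        main            : List E
        others          : List (List E)
        main-circuit    : Circuit main
        others-circuits : All Circuit others
        covers          : main ++ concat others ↭ M

    open Decomposition

    splice-step : ∀ {M} (D : Decomposition M) → Meets (main D) (others D) →
                  Σ (Decomposition M) λ D′ → suc (length (others D′)) ≡ length (others D)
    splice-step {M} (decomposition C Ts c cs covers) (_ , visC , visTs)
      with find visC | find visTs
    ... | e , e∈C , e↦u | T , T∈Ts , visT with find visT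
    ... | f , f∈T , f↦u with ∈-∃++ e∈C | ∈-∃++ T∈Ts | ∈-∃++ f∈T
    ... | A , B , refl | Ts₁ , Ts₂ , refl | A′ , B′ , refl with All.++⁻ Ts₁ cs
    ... | cs₁ , cT ∷ cs₂ =
      decomposition spliced (Ts₁ ++ Ts₂) (splice A e B A′ f B′ c cT (trans e↦u (sym f↦u)))
                    (All.++⁺ cs₁ cs₂) covers′ ,
      sym (↭-length (shift (A′ ++ f ∷ B′) Ts₁ Ts₂))
      where
      spliced C₀ T₀ : List E
      spliced = (e ∷ B ++ A) ++ (f ∷ B′ ++ A′)
      C₀ = A ++ e ∷ B
      T₀ = A′ ++ f ∷ B′
      covers′ : spliced ++ concat (Ts₁ ++ Ts₂) ↭ M
      covers′ = begin
        spliced ++ concat (Ts₁ ++ Ts₂)   ↭⟨ ++⁺ʳ _ (++⁺ (++-comm (e ∷ B) A) (++-comm (f ∷ B′) A′)) ⟩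
        (C₀ ++ T₀) ++ concat (Ts₁ ++ Ts₂) ≡⟨ List.++-assoc C₀ T₀ _ ⟩
        C₀ ++ T₀ ++ concat (Ts₁ ++ Ts₂)   ↭⟨ ++⁺ˡ C₀ (concat-remove-↭ Ts₁ T₀ Ts₂) ⟩
        C₀ ++ concat (Ts₁ ++ T₀ ∷ Ts₂)    ↭⟨ covers ⟩
        M                                  ∎
        where open PermutationReasoning

    module _ (M : List E) (edges-in-M : ∀ {e} → Edge e → e ∈ M)
             (connected : ∀ {e f} → e ∈ M → f ∈ M → Connected (src e) (src f)) where

      main-meets-others : ∀ C T Ts → Circuit C → All Circuit (T ∷ Ts) → C ++ concat (T ∷ Ts) ↭ M →
                          Meets C (T ∷ Ts)
      main-meets-others (c ∷ C) (f ∷ T) Ts cC cTs covers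
        with meets-or-invariant (c ∷ C) ((f ∷ T) ∷ Ts) cC cTs (∈-resp-↭ (↭-sym covers) ∘ edges-in-M)
               (connected (∈-resp-↭ covers (here refl)) (∈-resp-↭ covers (∈-++⁺ʳ (c ∷ C) (here refl))))
      ... | inj₁ meets = meets
      ... | inj₂ iff   = src f , Equivalence.to iff (here refl) , here (here refl)
      main-meets-others (_ ∷ _) [] _ _ (() ∷ _) _

      splice-all : ∀ n (D : Decomposition M) → length (others D) ≡ n → Σ (List E) λ C → Circuit C × C ↭ M
      splice-all _ (decomposition C [] c _ covers) _ = C , c , ↭-trans (↭-reflexive (sym (List.++-identityʳ C))) covers
      splice-all (suc n) D@(decomposition C (T ∷ Ts) c cs covers) len
        with splice-step D (main-meets-others C T Ts c cs covers)
      ... | D′ , shorter = splice-all n D′ (suc-injective (trans shorter len))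

  module Orbits (_≟E_ : DecidableEquality E) (σ : E → E) (σ-injective : ∀ {x y} → σ x ≡ σ y → x ≡ y)
                (src-σ : ∀ e → src (σ e) ≡ tgt e) where

    σ^ : ℕ → E → E
    σ^ m e = ℕ.iterate σ e m

    orbit : E → ℕ → List E
    orbit e m = iterate σ e m

    σ^-σ : ∀ m e → σ^ m (σ e) ≡ σ (σ^ m e)
    σ^-σ zero    e = refl
    σ^-σ (suc m) e = σ^-σ m (σ e)

    orbit-σ : ∀ m e → orbit (σ e) m ≡ map σ (orbit e m)
    orbit-σ zero    e = refl
    orbit-σ (suc m) e = cong (σ e ∷_) (orbit-σ m (σ e))

    orbit-snoc : ∀ m e → orbit e (suc m) ≡ orbit e m ++ [ σ^ m e ]
    orbit-snoc zero    e = refl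
    orbit-snoc (suc m) e = cong (e ∷_) (orbit-snoc m (σ e))

    orbit-walk : ∀ m e → Walk (src e) (src (σ^ m e)) (orbit e m)
    orbit-walk zero    e = refl
    orbit-walk (suc m) e = refl , subst (λ v → Walk v (src (σ^ m (σ e))) (orbit (σ e) m)) (src-σ e) (orbit-walk m (σ e))

    orbit-extend : ∀ m e → σ^ (suc m) e ≢ e → Unique (orbit e (suc m)) → Unique (orbit e (suc (suc m)))
    orbit-extend m e open′ u =
      subst Unique (sym (orbit-snoc (suc m) e)) (Unique-++⁺ u ([] ∷ []) λ { (m∈ , here refl) → new m∈ })
      where
      new : σ^ (suc m) e ∉ orbit e (suc m)
      new (here eq) = open′ eq
      new (there m∈) with ∈-map⁻ σ (subst (σ^ m (σ e) ∈_) (orbit-σ m e) m∈)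
      ... | y , y∈ , eq =
        unique-∉ (orbit e m) {b = []} (subst Unique (orbit-snoc m e) u)
          (subst (_∈ orbit e m ++ []) (sym (σ-injective (trans (sym (σ^-σ m e)) eq))) (∈-++⁺ˡ y∈))

    Cycle : E → ℕ → Set
    Cycle e p = σ^ (suc p) e ≡ e × Unique (orbit e (suc p))

    cycle-circuit : ∀ {e p} → Cycle e p → Circuit (orbit e (suc p))
    cycle-circuit {e} {p} (closes , _) = subst (λ x → Walk (src e) (src x) (orbit e (suc p))) closes (orbit-walk (suc p) e)

    -- A cycle is closed under σ⁻¹, so σ maps its complement into its complement.
    σ-outside-cycle : ∀ {e p} → Cycle e p → ∀ {x} → x ∉ orbit e (suc p) → σ x ∉ orbit e (suc p)
    σ-outside-cycle {e} {p} (closes , _) {x} x∉ (here σx≡e) =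
      x∉ (subst (_∈ orbit e (suc p)) (sym (σ-injective (trans σx≡e (trans (sym closes) (σ^-σ p e)))))
                (subst (σ^ p e ∈_) (sym (orbit-snoc p e)) (∈-++⁺ʳ (orbit e p) (here refl))))
    σ-outside-cycle {e} {p} _ {x} x∉ (there σx∈) with ∈-map⁻ σ (subst (σ x ∈_) (orbit-σ p e) σx∈)
    ... | y , y∈ , eq = x∉ (subst (_∈ orbit e (suc p)) (sym (σ-injective eq))
                                  (subst (y ∈_) (sym (orbit-snoc p e)) (∈-++⁺ˡ y∈)))

    σ-Closed : List E → Set
    σ-Closed L = ∀ {x} → x ∈ L → σ x ∈ L

    module _ {L : List E} (closed : σ-Closed L) where

      orbit-⊆ : ∀ m {e} → e ∈ L → ∀ {x} → x ∈ orbit e m → x ∈ L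
      orbit-⊆ (suc m) e∈ (here refl) = e∈
      orbit-⊆ (suc m) e∈ (there x∈)  = orbit-⊆ m (closed e∈) x∈

      -- Pigeonhole: the orbit of e ∈ L cannot stay injective for more than length L steps,
      -- so it closes up into a cycle.
      find-cycle : ∀ {e} → e ∈ L → ∀ fuel m → Unique (orbit e (suc m)) → length L < suc m + fuel →
                   Σ ℕ (Cycle e)
      find-cycle {e} e∈ zero m u tooLong =
        ⊥-elim (<-irrefl refl (<-≤-trans tooLong
          (subst (_≤ length L) (trans (List.length-iterate σ e (suc m)) (sym (+-identityʳ (suc m))))
                 (unique-length-≤ u (orbit-⊆ (suc m) e∈)))))
      find-cycle {e} e∈ (suc fuel) m u tooLong with σ^ (suc m) e ≟E e
      ... | yes closes = m , closes , u
      ... | no open′   = find-cycle e∈ fuel (suc m) (orbit-extend m e open′ u) (subst (length L <_) (+-suc (suc m) fuel) tooLong)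

    record CircuitCover (L : List E) : Set where
      constructor cover
      field
        circuits     : List (List E)
        are-circuits : All Circuit circuits
        disjoint     : Unique (concat circuits)
        sound        : ∀ {x} → x ∈ concat circuits → x ∈ L
        complete     : ∀ {x} → x ∈ L → x ∈ concat circuits

    cycle-cover : ∀ fuel (L : List E) → length L ≤ fuel → σ-Closed L → CircuitCover L
    cycle-cover _          []       _          _      = cover [] [] [] (λ ()) (λ ())
    cycle-cover (suc fuel) (e ∷ L₀) (s≤s len≤) closed =
      cover (O ∷ circuits) (cycle-circuit cyc ∷ are-circuits) disjoint′ sound′ complete′
      where
      open DecMembership _≟E_ using (_∈?_)
      found : Σ ℕ (Cycle e)
      found = find-cycle closed (here refl) (length (e ∷ L₀)) 0 ([] ∷ []) (n<1+n _)
      cyc : Cycle e (proj₁ found)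
      cyc = proj₂ found
      O : List E
      O = orbit e (suc (proj₁ found))
      outside? : (x : E) → Dec (x ∉ O)
      outside? x = ¬? (x ∈? O)
      rest : List E
      rest = filter outside? L₀
      rest-closed : σ-Closed rest
      rest-closed x∈ with ∈-filter⁻ outside? x∈
      ... | x∈L₀ , x∉O with closed (there x∈L₀)
      ... | here σx≡e = ⊥-elim (σ-outside-cycle cyc x∉O (subst (_∈ O) (sym σx≡e) (here refl)))
      ... | there σx∈ = ∈-filter⁺ outside? σx∈ (σ-outside-cycle cyc x∉O)
      open CircuitCover (cycle-cover fuel rest (≤-trans (List.length-filter outside? L₀) len≤) rest-closed)
      disjoint′ : Unique (O ++ concat circuits)
      disjoint′ = Unique-++⁺ (proj₂ cyc) disjoint λ { (x∈O , x∈) → proj₂ (∈-filter⁻ outside? {xs = L₀} (sound x∈)) x∈O }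
      sound′ : ∀ {x} → x ∈ O ++ concat circuits → x ∈ e ∷ L₀
      sound′ x∈ with ∈-++⁻ O x∈
      ... | inj₁ x∈O = orbit-⊆ closed _ (here refl) x∈O
      ... | inj₂ x∈  = there (proj₁ (∈-filter⁻ outside? {xs = L₀} (sound x∈)))
      complete′ : ∀ {x} → x ∈ e ∷ L₀ → x ∈ O ++ concat circuits
      complete′ (here refl) = here refl
      complete′ {x} (there x∈L₀) with x ∈? O
      ... | yes x∈O = ∈-++⁺ˡ x∈O
      ... | no x∉O  = ∈-++⁺ʳ O (complete (∈-filter⁺ outside? x∈L₀ x∉O))

    record EulerianCircuit (L : List E) : Set where
      field
        circuit  : List E
        closed   : Circuit⁰ circuit
        distinct : Unique circuit
        sound    : ∀ {x} → x ∈ circuit → x ∈ L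
        complete : ∀ {x} → x ∈ L → x ∈ circuit

    module _ (_≟V_ : DecidableEquality V) (Edge : E → Set) where
      open Splicing _≟V_ Edge

      eulerian-circuit : (L : List E) → σ-Closed L → (∀ {e} → Edge e → e ∈ L) →
                         (∀ {e f} → e ∈ L → f ∈ L → Connected (src e) (src f)) → EulerianCircuit L
      eulerian-circuit L closed edges-in-L connected with cycle-cover (length L) L ≤-refl closed
      ... | cover [] _ _ _ complete = record
        { circuit = [] ; closed = tt ; distinct = [] ; sound = λ () ; complete = complete }
      ... | cover (T ∷ Ts) (cT ∷ cTs) disjoint sound complete
        with splice-all (concat (T ∷ Ts)) (complete ∘ edges-in-L) (λ e∈ f∈ → connected (sound e∈) (sound f∈))
               (length Ts) (decomposition T Ts cT cTs ↭-refl) refl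
      ... | C@(_ ∷ _) , c , C↭M = record
        { circuit  = C
        ; closed   = c
        ; distinct = unique-↭ (↭-sym C↭M) disjoint
        ; sound    = sound ∘ ∈-resp-↭ C↭M
        ; complete = ∈-resp-↭ (↭-sym C↭M) ∘ complete }

module _ {A : Set} where

  rotate₁ : ∀ {m} → Vec A m → Vec A m
  rotate₁ []       = []
  rotate₁ (x ∷ xs) = xs ∷ʳ x

  rotate : ∀ {m} → ℕ → Vec A m → Vec A m
  rotate zero    v = v
  rotate (suc r) v = rotate₁ (rotate r v)

  rotate₁-injective : ∀ {m} {v w : Vec A m} → rotate₁ v ≡ rotate₁ w → v ≡ w
  rotate₁-injective {v = []}     {[]}     _  = refl
  rotate₁-injective {v = x ∷ xs} {y ∷ ys} eq with ∷ʳ-injective xs ys eq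
  ... | refl , refl = refl

  rotate-injective : ∀ {m} r {v w : Vec A m} → rotate r v ≡ rotate r w → v ≡ w
  rotate-injective zero    eq = eq
  rotate-injective (suc r) eq = rotate-injective r (rotate₁-injective eq)

  toList-rotate₁ : ∀ {m} (v : Vec A m) → toList (rotate₁ v) ≡ drop 1 (toList v) ++ take 1 (toList v)
  toList-rotate₁ []       = refl
  toList-rotate₁ (x ∷ xs) = toList-∷ʳ x xs

  toList-rotate : ∀ {m} r (v : Vec A m) → r ≤ m → toList (rotate r v) ≡ drop r (toList v) ++ take r (toList v)
  toList-rotate zero    v _   = sym (List.++-identityʳ (toList v))
  toList-rotate (suc r) v r<m with take-drop-step r (toList v) (subst (r <_) (sym (length-toList v)) r<m)
  ... | y , drop≡ , take≡ = begin
      toList (rotate₁ (rotate r v))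
    ≡⟨ toList-rotate₁ (rotate r v) ⟩
      drop 1 (toList (rotate r v)) ++ take 1 (toList (rotate r v))
    ≡⟨ cong (λ l → drop 1 l ++ take 1 l) (trans (toList-rotate r v (<⇒≤ r<m)) (cong (_++ take r (toList v)) drop≡)) ⟩
      (drop (suc r) (toList v) ++ take r (toList v)) ++ [ y ]
    ≡⟨ List.++-assoc (drop (suc r) (toList v)) _ _ ⟩
      drop (suc r) (toList v) ++ take r (toList v) ++ [ y ]
    ≡⟨ cong (drop (suc r) (toList v) ++_) take≡ ⟨
      drop (suc r) (toList v) ++ take (suc r) (toList v)
    ∎
    where open ≡-Reasoning

words : ∀ {A : Set} → List A → (k : ℕ) → List (Vec A k)
words xs zero    = [ [] ]
words xs (suc k) = concatMap (λ x → map (x ∷_) (words xs k)) xs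

words-complete : ∀ {A : Set} {xs : List A} → (∀ x → x ∈ xs) → ∀ k (v : Vec A k) → v ∈ words xs k
words-complete all∈ zero    []       = here refl
words-complete {xs = xs} all∈ (suc k) (x ∷ v) =
  ∈-concatMap⁺ (λ y → map (y ∷_) (words xs k)) (Any.map (λ { refl → ∈-map⁺ (x ∷_) (words-complete all∈ k v) }) (all∈ x))

module FreshLetters (n : ℕ) where
  open DecMembership (Fin._≟_ {n}) using (_∈?_)

  covering-length : (avoid : List (Fin n)) → (∀ z → z ∈ avoid) → n ≤ length avoid
  covering-length avoid all∈ =
    subst (_≤ length avoid) (List.length-tabulate id) (unique-length-≤ (allFin⁺ n) (λ {z} _ → all∈ z))

  fresh : (avoid : List (Fin n)) → length avoid < n → Σ (Fin n) (_∉ avoid)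
  fresh avoid short with any? (λ z → ¬? (z ∈? avoid)) (allFin n)
  ... | yes found with find found
  ...   | z , _ , z∉ = z , z∉
  fresh avoid short | no none = ⊥-elim (<-irrefl refl (<-≤-trans short (covering-length avoid occurs)))
    where
    occurs : ∀ z → z ∈ avoid
    occurs z = decidable-stable (z ∈? avoid) (λ z∉ → none (Any.map (λ { refl → z∉ }) (∈-allFin z)))

  record FreshList (avoid : List (Fin n)) (m : ℕ) : Set where
    field
      letters  : List (Fin n)
      size     : length letters ≡ m
      distinct : Unique letters
      avoids   : ∀ {x} → x ∈ letters → x ∉ avoid

  fresh-list : ∀ avoid m → length avoid + m ≤ n → FreshList avoid m
  fresh-list avoid zero    _    = record { letters = [] ; size = refl ; distinct = [] ; avoids = λ () }
  fresh-list avoid (suc m) room = extend (fresh avoid (≤-trans (s≤s (m≤m+n (length avoid) m)) room′))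
    where
    room′ : suc (length avoid + m) ≤ n
    room′ = subst (_≤ n) (+-suc (length avoid) m) room
    extend : Σ (Fin n) (_∉ avoid) → FreshList avoid (suc m)
    extend (z , z∉) = record
      { letters  = z ∷ letters
      ; size     = cong suc size
      ; distinct = All.¬Any⇒All¬ letters (λ z∈ → avoids z∈ (here refl)) ∷ distinct
      ; avoids   = λ { (here refl) → z∉ ; (there x∈) x∈avoid → avoids x∈ (there x∈avoid) } }
      where open FreshList (fresh-list (z ∷ avoid) m room′)

-- The overlap graph: the k-permutation w is an edge from its first s letters to its last s
-- letters, so that s-overlap cycles on the k-permutations are exactly its Eulerian circuits.
module OverlapGraph (n s k : ℕ) (s<k : s < k) (k<n : k < n) where
  open FreshLetters n
  open DecMembership (Fin._≟_ {n}) using (_∈?_)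

  r : ℕ
  r = k ∸ s

  s≤k : s ≤ k
  s≤k = <⇒≤ s<k

  s+r≡k : s + r ≡ k
  s+r≡k = m+[n∸m]≡n s≤k

  k∸r≡s : k ∸ r ≡ s
  k∸r≡s = m∸[m∸n]≡n s≤k

  src tgt : Word n k → List (Fin n)
  src w = take s (toList w)
  tgt w = drop r (toList w)

  open Trails src tgt public
  open Splicing (List.≡-dec Fin._≟_) IsKPerm public

  -- Duplicate-free letter lists of length s (vertices) and of length k (edges).
  SPerm KPerm : List (Fin n) → Set
  SPerm v = length v ≡ s × Unique v
  KPerm l = length l ≡ k × Unique l

  kperm-edge : ∀ {l} → KPerm l → Connected (take s l) (drop r l)
  kperm-edge {l} (|l| , ul) = subst₂ Connected (cong (take s) w≡l) (cong (drop r) w≡l) (c-edge (subst Unique (sym w≡l) ul))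
    where
    w : Word n k
    w = cast |l| (fromList l)
    w≡l : toList w ≡ l
    w≡l = trans (toList-cast |l| (fromList l)) (toList∘fromList l)

  take-sperm : ∀ {l} → KPerm l → SPerm (take s l)
  take-sperm {l} (|l| , ul) = trans (List.length-take s l) (trans (cong (s ⊓_) |l|) (m≤n⇒m⊓n≡m s≤k)) , take⁺ s ul

  length-drop-r : ∀ {l : List (Fin n)} → length l ≡ k → length (drop r l) ≡ s
  length-drop-r {l} |l| = trans (List.length-drop r l) (trans (cong (_∸ r) |l|) k∸r≡s)

  drop-sperm : ∀ {l} → KPerm l → SPerm (drop r l)
  drop-sperm (|l| , ul) = length-drop-r |l| , drop⁺ r ul

  pad-kperm : ∀ {v X} → SPerm v → length X ≡ r → Unique X → (∀ {x} → x ∈ X → x ∉ v) → KPerm (v ++ X)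
  pad-kperm {v} (|v| , uv) |X| uX X∩v =
    trans (List.length-++ v) (trans (cong₂ _+_ |v| |X|) s+r≡k) , Unique-++⁺ uv uX (λ { (x∈v , x∈X) → X∩v x∈X x∈v })

  padded-edge : ∀ {v X} → SPerm v → length X ≡ r → Unique X → (∀ {x} → x ∈ X → x ∉ v) → Connected v (drop r (v ++ X))
  padded-edge {v} {X} sv |X| uX X∩v =
    subst (λ u → Connected u (drop r (v ++ X))) (take-++-length s v X (proj₁ sv)) (kperm-edge (pad-kperm sv |X| uX X∩v))

  replace-sperm : ∀ u {x y t} → SPerm (u ++ x ∷ t) → y ∉ u ++ x ∷ t → SPerm (u ++ y ∷ t)
  replace-sperm u (|v| , uv) y∉ = trans (length-replace u) |v| , unique-replace u uv y∉

  -- Replacing a letter x of an s-permutation by an unused letter y stays inside one connected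
  -- component: pad both vertices with the same r fresh letters and follow the two edges.
  -- Their targets coincide if x is among the first r letters; otherwise they differ only in
  -- the letter r places further to the front, and we recurse on the position of x.
  replace-connected : ∀ fuel u x t y → length u < fuel → SPerm (u ++ x ∷ t) → y ∉ u ++ x ∷ t →
                      Connected (u ++ x ∷ t) (u ++ y ∷ t)
  replace-connected (suc fuel) u x t y |u|<1+fuel sv y∉v =
    c-trans (padded-edge sv size distinct X∩v) (c-trans (shifted (length u <? r)) (c-sym (padded-edge sv′ size distinct X∩v′)))
    where
    v v′ : List (Fin n)
    v  = u ++ x ∷ t
    v′ = u ++ y ∷ t
    room : length (y ∷ v) + r ≤ n
    room = subst (λ m → suc m + r ≤ n) (sym (proj₁ sv)) (subst (λ m → suc m ≤ n) (sym s+r≡k) k<n)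
    open FreshList (fresh-list (y ∷ v) r room) renaming (letters to X)
    sv′ : SPerm v′
    sv′ = replace-sperm u sv y∉v
    X∩v : ∀ {z} → z ∈ X → z ∉ v
    X∩v z∈X = avoids z∈X ∘ there
    X∩v′ : ∀ {z} → z ∈ X → z ∉ v′
    X∩v′ z∈X z∈v′ with ∈-removed u z∈v′
    ... | inj₁ refl = avoids z∈X (here refl)
    ... | inj₂ z∈   = avoids z∈X (there (∈-inserted u z∈))
    shifted : Dec (length u < r) → Connected (drop r (v ++ X)) (drop r (v′ ++ X))
    shifted (yes |u|<r) = ≡⇒Connected (begin
        drop r (v ++ X)          ≡⟨ cong (drop r) (List.++-assoc u (x ∷ t) X) ⟩
        drop r (u ++ x ∷ t ++ X) ≡⟨ drop-beyond r u (t ++ X) |u|<r ⟩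
        drop r (u ++ y ∷ t ++ X) ≡⟨ cong (drop r) (List.++-assoc u (y ∷ t) X) ⟨
        drop r (v′ ++ X)         ∎)
      where open ≡-Reasoning
    shifted (no |u|≮r) =
      subst₂ Connected (sym (moved x)) (sym (moved y)) (replace-connected fuel (drop r u) x (t ++ X) y shorter sD y∉D)
      where
      r≤|u| : r ≤ length u
      r≤|u| = ≮⇒≥ |u|≮r
      moved : ∀ z → drop r ((u ++ z ∷ t) ++ X) ≡ drop r u ++ z ∷ t ++ X
      moved z = trans (cong (drop r) (List.++-assoc u (z ∷ t) X)) (drop-++-≤ r u (z ∷ t ++ X) r≤|u|)
      sD : SPerm (drop r u ++ x ∷ t ++ X)
      sD = subst SPerm (moved x) (drop-sperm (pad-kperm sv size distinct X∩v))
      y∉D : y ∉ drop r u ++ x ∷ t ++ X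
      y∉D y∈ with ∈-++⁻ v (∈-drop r (subst (y ∈_) (sym (moved x)) y∈))
      ... | inj₁ y∈v = y∉v y∈v
      ... | inj₂ y∈X = avoids y∈X (here refl)
      shorter : length (drop r u) < fuel
      shorter = subst (_< fuel) (sym (List.length-drop r u)) (<-≤-trans (∸-monoʳ-< (m<n⇒0<n∸m s<k) r≤|u|) (≤-pred |u|<1+fuel))

  replace : ∀ u x t y → SPerm (u ++ x ∷ t) → y ∉ u ++ x ∷ t → Connected (u ++ x ∷ t) (u ++ y ∷ t)
  replace u x t y = replace-connected (suc (length u)) u x t y (n<1+n _)

  -- If y occurs later in the vertex, first replace that occurrence by an unused letter z
  -- (one exists as s < n), and then replace x by y.
  bring-forward : ∀ c x m y t → SPerm (c ++ x ∷ m ++ y ∷ t) →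
                  Σ (List (Fin n)) λ p′ → length p′ ≡ length (m ++ y ∷ t) × SPerm (c ++ y ∷ p′) ×
                                          Connected (c ++ x ∷ m ++ y ∷ t) (c ++ y ∷ p′)
  bring-forward c x m y t sv with fresh (c ++ x ∷ m ++ y ∷ t) (subst (_< n) (sym (proj₁ sv)) (<-trans s<k k<n))
  ... | z , z∉ = m ++ z ∷ t , length-replace m , replace-sperm c su y∉u , c-trans step₁ (replace c x (m ++ z ∷ t) y su y∉u)
    where
    assoc : ∀ w → (c ++ x ∷ m) ++ w ∷ t ≡ c ++ x ∷ m ++ w ∷ t
    assoc w = List.++-assoc c (x ∷ m) (w ∷ t)
    sv₁ : SPerm ((c ++ x ∷ m) ++ y ∷ t)
    sv₁ = subst SPerm (sym (assoc y)) sv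
    z∉₁ : z ∉ (c ++ x ∷ m) ++ y ∷ t
    z∉₁ = subst (z ∉_) (sym (assoc y)) z∉
    step₁ : Connected (c ++ x ∷ m ++ y ∷ t) (c ++ x ∷ m ++ z ∷ t)
    step₁ = subst₂ Connected (assoc y) (assoc z) (replace (c ++ x ∷ m) y t z sv₁ z∉₁)
    su : SPerm (c ++ x ∷ m ++ z ∷ t)
    su = subst SPerm (assoc z) (replace-sperm (c ++ x ∷ m) sv₁ z∉₁)
    y∉u : y ∉ c ++ x ∷ m ++ z ∷ t
    y∉u y∈ with ∈-removed (c ++ x ∷ m) (subst (y ∈_) (sym (assoc z)) y∈)
    ... | inj₁ refl = z∉₁ (∈-++⁺ʳ (c ++ x ∷ m) (here refl))
    ... | inj₂ y∈′  = unique-∉ (c ++ x ∷ m) (proj₂ sv₁) y∈′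

  align-head : ∀ c x p y q → SPerm (c ++ x ∷ p) → SPerm (c ++ y ∷ q) →
               Σ (List (Fin n)) λ p′ → length p′ ≡ length p × SPerm (c ++ y ∷ p′) × Connected (c ++ x ∷ p) (c ++ y ∷ p′)
  align-head c x p y q sv sw with y ∈? (c ++ x ∷ p)
  ... | no y∉ = p , refl , replace-sperm c sv y∉ , replace c x p y sv y∉
  ... | yes y∈ with ∈-++⁻ c y∈
  ...   | inj₁ y∈c         = ⊥-elim (unique-∉ c (proj₂ sw) (∈-++⁺ˡ y∈c))
  ...   | inj₂ (here refl) = p , refl , sv , c-refl
  ...   | inj₂ (there y∈p) with ∈-∃++ y∈p
  ...     | m , t , refl   = bring-forward c x m y t sv

  connect-suffix : ∀ c p q → length p ≡ length q → SPerm (c ++ p) → SPerm (c ++ q) → Connected (c ++ p) (c ++ q)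
  connect-suffix c []      []      _   _  _  = c-refl
  connect-suffix c (x ∷ p) (y ∷ q) len sv sw with align-head c x p y q sv sw
  ... | p′ , |p′| , sv′ , step =
    c-trans step (subst₂ Connected (assoc p′) (assoc q)
      (connect-suffix (c ++ [ y ]) p′ q (trans |p′| (suc-injective len)) (subst SPerm (sym (assoc p′)) sv′) (subst SPerm (sym (assoc q)) sw)))
    where
    assoc : ∀ l → (c ++ [ y ]) ++ l ≡ c ++ y ∷ l
    assoc l = List.++-assoc c [ y ] l

  sources-connected : ∀ {e f : Word n k} → IsKPerm e → IsKPerm f → Connected (src e) (src f)
  sources-connected {e} {f} ue uf =
    connect-suffix [] (src e) (src f) (trans (proj₁ se) (sym (proj₁ sf))) se sf
    where
    se : SPerm (src e)
    se = take-sperm (length-toList e , ue)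
    sf : SPerm (src f)
    sf = take-sperm (length-toList f , uf)

  -- Rotation by r letters maps each edge to an edge starting where the first one ends.
  σ : Word n k → Word n k
  σ = rotate r

  toList-σ : ∀ w → toList (σ w) ≡ tgt w ++ take r (toList w)
  toList-σ w = toList-rotate r w (m∸n≤m k s)

  src-σ : ∀ w → src (σ w) ≡ tgt w
  src-σ w = trans (cong (take s) (toList-σ w)) (take-++-length s (tgt w) _ (length-drop-r (length-toList w)))

  σ-kperm : ∀ {w} → IsKPerm w → IsKPerm (σ w)
  σ-kperm {w} uw = subst Unique (sym (toList-σ w))
    (unique-↭ (++-comm (take r (toList w)) (tgt w)) (subst Unique (sym (List.take++drop≡id r (toList w))) uw))

  open Orbits (Vecₚ.≡-dec Fin._≟_) σ (rotate-injective r) src-σ public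

  kperms : List (Word n k)
  kperms = filter (unique? Fin._≟_ ∘ toList) (words (allFin n) k)

  kperms-complete : ∀ {w} → IsKPerm w → w ∈ kperms
  kperms-complete {w} uw = ∈-filter⁺ (unique? Fin._≟_ ∘ toList) (words-complete ∈-allFin k w) uw

  kperms-sound : ∀ {w} → w ∈ kperms → IsKPerm w
  kperms-sound w∈ = proj₂ (∈-filter⁻ (unique? Fin._≟_ ∘ toList) {xs = words (allFin n) k} w∈)

  kperms-σ-closed : σ-Closed kperms
  kperms-σ-closed = kperms-complete ∘ σ-kperm ∘ kperms-sound

  walk-chain : ∀ first x xs {v} → Walk (tgt x) v xs → v ≡ src first → CyclicChain s first (x ∷ xs)
  walk-chain first x []       ends        closes = trans ends closes
  walk-chain first x (y ∷ ys) (starts , w) closes = sym starts , walk-chain first y ys w closes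

  circuit-overlaps : ∀ C → Circuit⁰ C → IsCyclicOverlap s C
  circuit-overlaps []       _       = tt
  circuit-overlaps (c ∷ cs) (_ , w) = walk-chain c c cs w refl

-- Main theorem: the rotation σ and the connectivity of the overlap graph give an Eulerian
-- circuit through all k-permutations, which is an s-overlap cycle (s = 0 would work as well).
mainTheorem4 : ∀ (n s k : ℕ) → 1 ≤ s → s < k → k < n → OCycleOnKPerms n k s
mainTheorem4 n s k _ s<k k<n = record
  { cycle     = circuit
  ; distinct  = distinct
  ; onlyPerms = kperms-sound ∘ sound
  ; allPerms  = λ _ → complete ∘ kperms-complete
  ; overlaps  = circuit-overlaps circuit closed
  }
  where
  open OverlapGraph n s k s<k k<n
  euler : EulerianCircuit kperms
  euler = eulerian-circuit (List.≡-dec Fin._≟_) IsKPerm kperms kperms-σ-closed kperms-complete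
            (λ e∈ f∈ → sources-connected (kperms-sound e∈) (kperms-sound f∈))
  open EulerianCircuit euler
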